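{- For each $n\ge1$, $D'_{3,2n,n}=\binom{3n}{n}-2\binom{3n}{n-1}+\binom{3n}{n-2}$.
   Context: A $3$-dimensional balanced ballot path of length $3n$ is a sequence of $3n$ standard unit vectors of $\mathbb{R}^3$, each of $\vec e_1,\vec e_2,\vec e_3$ occurring exactly $n$ times, such that every intermediate point (partial sum) $(x_1,x_2,x_3)$ satisfies $x_1\ge x_2\ge x_3$. The semisymmetric height of a point is $g_3(\vec x)=2x_1-2x_3$, and the semisymmetric height of a path is the maximum of $g_3$ over its intermediate points. $D'_{3,u,n}$ denotes the number of such paths of length $3n$ whose semisymmetric height is exactly $u$. Binomial coefficients with negative lower index are $0$. -}

module Defs where

open import Data.Nat using (ℕ; zero; suc; _+_; _*_; _≤_; _≤?_; _⊔_)
open import Data.Nat.Combinatorics using (_C_)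
open import Data.Integer using (ℤ; +_; -[1+_])
open import Data.Fin using (Fin; zero; suc)
open import Data.List using (List; []; _∷_; length; map; concatMap; filter)
open import Data.Product using (_×_; _,_)
open import Data.List.Relation.Unary.All using (All)
open import Relation.Nullary using (Dec; yes; no)
open import Relation.Nullary.Decidable using (_×-dec_)
open import Relation.Binary.PropositionalEquality using (_≡_)
import Data.Nat.Properties as ℕP
import Data.List.Relation.Unary.All as AllM

-- A step is one of the standard unit vectors e₁, e₂, e₃ (zero, suc zero, suc (suc zero)).
Step : Set
Step = Fin 3

-- A lattice point of ℤ³; all relevant points have nonnegative coordinates, so ℕ³.
Point : Set
Point = ℕ × ℕ × ℕ

move : Point → Step → Point
move (a , b , c) zero = (suc a , b , c)
move (a , b , c) (suc zero) = (a , suc b , c)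
move (a , b , c) (suc (suc zero)) = (a , b , suc c)

pointsFrom : Point → List Step → List Point
pointsFrom p [] = p ∷ []
pointsFrom p (s ∷ w) = p ∷ pointsFrom (move p s) w

points : List Step → List Point
points = pointsFrom (0 , 0 , 0)

endpoint : List Step → Point
endpoint = go (0 , 0 , 0)
  where
  go : Point → List Step → Point
  go p [] = p
  go p (s ∷ w) = go (move p s) w

Ordered : Point → Set
Ordered (a , b , c) = (b ≤ a) × (c ≤ b)

ordered? : (p : Point) → Dec (Ordered p)
ordered? (a , b , c) = (b ≤? a) ×-dec (c ≤? b)

-- semisymmetric height g₃(x) = 2x₁ − 2x₃ (only used on ordered points, where x₃ ≤ x₁)
g3 : Point → ℕ
g3 (a , b , c) = 2 * a Data.Nat.∸ 2 * c
  where import Data.Nat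

maximum : List ℕ → ℕ
maximum [] = 0
maximum (x ∷ xs) = x ⊔ maximum xs

height : List Step → ℕ
height w = maximum (map g3 (points w))

words : ℕ → List (List Step)
words zero = [] ∷ []
words (suc k) = concatMap (λ w → map (_∷ w) (zero ∷ suc zero ∷ suc (suc zero) ∷ [])) (words k)

IsBallot : ℕ → List Step → Set
IsBallot n w = (endpoint w ≡ (n , n , n)) × All Ordered (points w)

_≟P_ : (p q : Point) → Dec (p ≡ q)
_≟P_ = Data.Product.Properties.≡-dec ℕP._≟_ (Data.Product.Properties.≡-dec ℕP._≟_ ℕP._≟_)
  where import Data.Product.Properties

isBallot? : (n : ℕ) → (w : List Step) → Dec (IsBallot n w)
isBallot? n w = (endpoint w ≟P (n , n , n)) ×-dec AllM.all? ordered? (points w)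

HasHeight : ℕ → ℕ → List Step → Set
HasHeight n u w = IsBallot n w × (height w ≡ u)

hasHeight? : (n u : ℕ) → (w : List Step) → Dec (HasHeight n u w)
hasHeight? n u w = isBallot? n w ×-dec (height w ℕP.≟ u)

D' : ℕ → ℕ → ℕ
D' u n = length (filter (hasHeight? n u) (words (3 * n)))

-- binomial coefficient with integer lower index, 0 when the lower index is negative
choose : ℕ → ℤ → ℕ
choose m (+ k) = m C k
choose m -[1+ k ] = 0

{-# OPTIONS --safe #-}
-- A ballot path to (n, n, n) keeps x₁ ≤ n and x₃ ≥ 0, so its height 2x₁ − 2x₃ is at most 2n,
-- with equality exactly when it visits a point (n, y, 0), i.e. when all e₁ steps precede the
-- first e₃ step.  Such paths are counted from every intermediate point by recursion on the
-- first step; write B(m, k) = C(m, k) − C(m, k − 1).  Once x₁ = n, with b steps e₂ and c ≥ b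
-- steps e₃ left, the count is the ballot number B(b + c, b).  Before that, with x₃ = 0 and
-- r + 1 steps e₁, b steps e₂ and m steps in all left, it is B(m, b) − B(m, r).  Both closed
-- forms satisfy the recursion by Pascal's rule, also at the neighbours just outside the region,
-- where they vanish (as C(2k+1, k+1) = C(2k+1, k), and C(m, k) = 0 for k < 0).  At the origin
-- r + 1 = b = n and m = 3n, which gives B(3n, n) − B(3n, n − 1).

module Submission where

open import Defs
open import Data.Nat using (ℕ; _≤_; _*_)
open import Data.Integer using (ℤ; +_; _+_; _-_)
import Data.Integer
open import Relation.Binary.PropositionalEquality using (_≡_)

open import Data.Integer using (-[1+_])
open import Data.Nat using (zero; suc; _<_; _∸_; z≤n; z<s)
import Data.Nat as ℕ
import Data.Nat.Properties as ℕ
import Data.Nat.Tactic.RingSolver as ℕ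
open import Data.Nat.Combinatorics using (_C_; nCk≡nC[n∸k]; nCk+nC[k+1]≡[n+1]C[k+1])
import Data.Integer.Properties as ℤ
open import Data.Integer.Tactic.RingSolver using (solve-∀)
open import Data.Fin using (zero; suc)
open import Data.List using (List; []; _∷_; length; filter; map; concatMap)
open import Data.List.Properties using (filter-accept; filter-none)
open import Data.List.Relation.Unary.All as All using (All; []; _∷_)
import Data.List.Relation.Unary.All.Properties as All
open import Data.List.Relation.Unary.Any as Any using (Any; here; there)
import Data.List.Relation.Unary.Any.Properties as Any
open import Data.List.Membership.Propositional using (_∈_; find; lose)
open import Data.List.Membership.Propositional.Properties using (∈-map⁺)
open import Data.Product using (_×_; _,_; proj₁)
open import Data.Sum using ([_,_]′)
open import Data.Bool using (true; false; if_then_else_)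
open import Level using (0ℓ)
open import Relation.Nullary using (¬_; yes; no; does)
open import Relation.Nullary.Decidable using (_×-dec_)
open import Relation.Nullary.Negation using (contradiction)
open import Relation.Unary using (Pred; Decidable; _≐_; Empty)
open import Relation.Binary.PropositionalEquality using (refl; sym; trans; cong; cong₂; subst; module ≡-Reasoning)

open ≡-Reasoning

pattern e₁ = zero
pattern e₂ = suc zero
pattern e₃ = suc (suc zero)

origin : Point
origin = (0 , 0 , 0)

x₁ x₃ : Point → ℕ
x₁ (a , _ , _) = a
x₃ (_ , _ , c) = c

mutual
  walk : Point → List Step → Point
  walk = _

  -- The walker of `endpoint` is local to its where-block; once the start point is abstracted,
  -- unification solves `walk` as that walker.
  endpoint-∷ : ∀ s w → endpoint (s ∷ w) ≡ walk (move origin s) w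
  endpoint-∷ s w with move origin s
  ... | _ = refl

endpoint≡walk : ∀ w → endpoint w ≡ walk origin w
endpoint≡walk []      = refl
endpoint≡walk (s ∷ w) = endpoint-∷ s w

start∈pointsFrom : ∀ p w → p ∈ pointsFrom p w
start∈pointsFrom p []      = here refl
start∈pointsFrom p (_ ∷ _) = here refl

module _ (f : Point → ℕ) (f-move : ∀ p s → f p ≤ f (move p s)) where

  walk-mono : ∀ p w → f p ≤ f (walk p w)
  walk-mono p []      = ℕ.≤-refl
  walk-mono p (s ∷ w) = ℕ.≤-trans (f-move p s) (walk-mono (move p s) w)

  pointsFrom-between : ∀ p w → All (λ q → f p ≤ f q × f q ≤ f (walk p w)) (pointsFrom p w)
  pointsFrom-between p []      = (ℕ.≤-refl , ℕ.≤-refl) ∷ []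
  pointsFrom-between p (s ∷ w) =
    (ℕ.≤-refl , walk-mono p (s ∷ w))
    ∷ All.map (λ (lo , hi) → ℕ.≤-trans (f-move p s) lo , hi) (pointsFrom-between (move p s) w)

x₁-move : ∀ p s → x₁ p ≤ x₁ (move p s)
x₁-move (a , _ , _) e₁ = ℕ.n≤1+n a
x₁-move _           e₂ = ℕ.≤-refl
x₁-move _           e₃ = ℕ.≤-refl

x₃-move : ∀ p s → x₃ p ≤ x₃ (move p s)
x₃-move _           e₁ = ℕ.≤-refl
x₃-move _           e₂ = ℕ.≤-refl
x₃-move (_ , _ , c) e₃ = ℕ.n≤1+n c

g3≤2x₁ : ∀ q → g3 q ≤ 2 * x₁ q
g3≤2x₁ (a , _ , c) = ℕ.m∸n≤m (2 * a) (2 * c)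

g3<2x₁ : ∀ q → Ordered q → 0 < x₃ q → g3 q < 2 * x₁ q
g3<2x₁ (a , b , suc c) (b≤a , c≤b) _ =
  ℕ.∸-monoʳ-< z<s (ℕ.*-monoʳ-≤ 2 (ℕ.≤-trans c≤b b≤a))

maximum-≤ : ∀ {v xs} → All (_≤ v) xs → maximum xs ≤ v
maximum-≤ []         = z≤n
maximum-≤ (x≤v ∷ xs) = ℕ.⊔-lub x≤v (maximum-≤ xs)

∈⇒≤maximum : ∀ {x xs} → x ∈ xs → x ≤ maximum xs
∈⇒≤maximum {xs = y ∷ ys} (here refl) = ℕ.m≤m⊔n y (maximum ys)
∈⇒≤maximum {xs = y ∷ ys} (there x∈) = ℕ.≤-trans (∈⇒≤maximum x∈) (ℕ.m≤n⊔m y (maximum ys))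

maximum-∷-∈ : ∀ y ys → maximum (y ∷ ys) ∈ y ∷ ys
maximum-∷-∈ y []       = here (ℕ.⊔-identityʳ y)
maximum-∷-∈ y (z ∷ zs) = [ here , (λ max≡ → there (subst (_∈ z ∷ zs) (sym max≡) (maximum-∷-∈ z zs))) ]′
                           (ℕ.⊔-sel y (maximum (z ∷ zs)))

maximum-∈ : ∀ {x xs} → x ∈ xs → maximum xs ∈ xs
maximum-∈ {xs = y ∷ ys} _ = maximum-∷-∈ y ys

module _ {A : Set} where

  count : {P : Pred A 0ℓ} → Decidable P → List A → ℕ
  count P? xs = length (filter P? xs)

  count-∷ : {P : Pred A 0ℓ} (P? : Decidable P) → ∀ x xs →
            count P? (x ∷ xs) ≡ (if does (P? x) then 1 else 0) ℕ.+ count P? xs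
  count-∷ P? x xs with does (P? x)
  ... | true  = refl
  ... | false = refl

  count-cong : {P Q : Pred A 0ℓ} (P? : Decidable P) (Q? : Decidable Q) → P ≐ Q →
               ∀ xs → count P? xs ≡ count Q? xs
  count-cong P? Q? _                 []       = refl
  count-cong P? Q? P≐Q@(P⊆Q , Q⊆P) (x ∷ xs) with P? x | Q? x
  ... | yes _  | yes _  = cong suc (count-cong P? Q? P≐Q xs)
  ... | yes px | no ¬qx = contradiction (P⊆Q px) ¬qx
  ... | no ¬px | yes qx = contradiction (Q⊆P qx) ¬px
  ... | no _   | no _   = count-cong P? Q? P≐Q xs

  count-empty : {P : Pred A 0ℓ} (P? : Decidable P) → Empty P → ∀ xs → count P? xs ≡ 0
  count-empty P? ∅ xs = cong length (filter-none P? (All.universal ∅ xs))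

Σ-step : (Step → ℕ) → ℕ
Σ-step f = f e₁ ℕ.+ f e₂ ℕ.+ f e₃

Σ-step-cong : ∀ {f g} → (∀ s → f s ≡ g s) → Σ-step f ≡ Σ-step g
Σ-step-cong f≗g = cong₂ ℕ._+_ (cong₂ ℕ._+_ (f≗g e₁) (f≗g e₂)) (f≗g e₃)

+-Σ-step : ∀ f → + Σ-step f ≡ + f e₁ + + f e₂ + + f e₃
+-Σ-step f = trans (ℤ.pos-+ (f e₁ ℕ.+ f e₂) (f e₃)) (cong (_+ + f e₃) (ℤ.pos-+ (f e₁) (f e₂)))

count-words-suc : {P : Pred (List Step) 0ℓ} (P? : Decidable P) → ∀ m →
                  count P? (words (suc m)) ≡ Σ-step (λ s → count (λ w → P? (s ∷ w)) (words m))
count-words-suc P? m = go (words m)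
  where
  shuffle : ∀ a b c x y z →
            a ℕ.+ (b ℕ.+ (c ℕ.+ (x ℕ.+ y ℕ.+ z))) ≡ (a ℕ.+ x) ℕ.+ (b ℕ.+ y) ℕ.+ (c ℕ.+ z)
  shuffle = ℕ.solve-∀

  go : ∀ ws → count P? (concatMap (λ w → map (_∷ w) (e₁ ∷ e₂ ∷ e₃ ∷ [])) ws)
            ≡ Σ-step (λ s → count (λ w → P? (s ∷ w)) ws)
  go []       = refl
  go (w ∷ ws) = begin
      count P? ((e₁ ∷ w) ∷ (e₂ ∷ w) ∷ (e₃ ∷ w) ∷ rest)
    ≡⟨ count-∷ P? _ _ ⟩
      hit e₁ ℕ.+ count P? ((e₂ ∷ w) ∷ (e₃ ∷ w) ∷ rest)
    ≡⟨ cong (hit e₁ ℕ.+_) (count-∷ P? _ _) ⟩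
      hit e₁ ℕ.+ (hit e₂ ℕ.+ count P? ((e₃ ∷ w) ∷ rest))
    ≡⟨ cong (λ k → hit e₁ ℕ.+ (hit e₂ ℕ.+ k)) (count-∷ P? _ _) ⟩
      hit e₁ ℕ.+ (hit e₂ ℕ.+ (hit e₃ ℕ.+ count P? rest))
    ≡⟨ cong (λ k → hit e₁ ℕ.+ (hit e₂ ℕ.+ (hit e₃ ℕ.+ k))) (go ws) ⟩
      hit e₁ ℕ.+ (hit e₂ ℕ.+ (hit e₃ ℕ.+ Σ-step next))
    ≡⟨ shuffle (hit e₁) (hit e₂) (hit e₃) (next e₁) (next e₂) (next e₃) ⟩
      Σ-step (λ s → hit s ℕ.+ next s)
    ≡⟨ Σ-step-cong (λ s → sym (count-∷ (λ v → P? (s ∷ v)) w ws)) ⟩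
      Σ-step (λ s → count (λ v → P? (s ∷ v)) (w ∷ ws))
    ∎
    where
    rest = concatMap (λ v → map (_∷ v) (e₁ ∷ e₂ ∷ e₃ ∷ [])) ws
    hit : Step → ℕ
    hit s = if does (P? (s ∷ w)) then 1 else 0
    next : Step → ℕ
    next s = count (λ v → P? (s ∷ v)) ws

suc[n∸suc[k]]≡n∸k : ∀ {n k} → suc k ≤ n → suc (n ∸ suc k) ≡ n ∸ k
suc[n∸suc[k]]≡n∸k le = sym (ℕ.+-∸-assoc 1 le)

ballot : ℕ → ℤ → ℤ
ballot m k = + choose m k - + choose m (k - + 1)

choose-pascal : ∀ m k → + choose (suc m) k ≡ + choose m k + + choose m (k - + 1)
choose-pascal m (+ zero)  = refl
choose-pascal m -[1+ _ ]  = refl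
choose-pascal m (+ suc k) = begin
  + (suc m C suc k)          ≡⟨ cong +_ (nCk+nC[k+1]≡[n+1]C[k+1] m k) ⟨
  + (m C k ℕ.+ m C suc k)    ≡⟨ ℤ.pos-+ (m C k) (m C suc k) ⟩
  + (m C k) + + (m C suc k)  ≡⟨ ℤ.+-comm (+ (m C k)) (+ (m C suc k)) ⟩
  + (m C suc k) + + (m C k)  ∎

ballot-pascal : ∀ m k → ballot (suc m) k ≡ ballot m k + ballot m (k - + 1)
ballot-pascal m k = begin
  ballot (suc m) k
    ≡⟨ cong₂ _-_ (choose-pascal m k) (choose-pascal m k′) ⟩
  (+ choose m k + + choose m k′) - (+ choose m k′ + + choose m k″)
    ≡⟨ regroup (+ choose m k) (+ choose m k′) (+ choose m k″) ⟩
  ballot m k + ballot m k′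
    ∎
  where
  k′ = k - + 1
  k″ = k′ - + 1
  regroup : ∀ a b c → (a + b) - (b + c) ≡ (a - b) + (b - c)
  regroup = solve-∀

ballot-central : ∀ k → ballot (suc k ℕ.+ k) (+ suc k) ≡ + 0
ballot-central k = begin
  + (m C suc k) - + (m C k)  ≡⟨ cong (λ j → + j - + (m C k)) symmetric ⟩
  + (m C k) - + (m C k)      ≡⟨ ℤ.+-inverseʳ (+ (m C k)) ⟩
  + 0                        ∎
  where
  m = suc k ℕ.+ k
  symmetric : m C suc k ≡ m C k
  symmetric = trans (nCk≡nC[n∸k] (ℕ.m≤m+n (suc k) k)) (cong (m C_) (ℕ.m+n∸m≡n (suc k) k))

ballot-difference : ∀ m i → ballot m i - ballot m (i - + 1)
                          ≡ (+ choose m i - (+ 2) Data.Integer.* (+ choose m (i - + 1))) + + choose m (i - + 2)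
ballot-difference m i = begin
  (C i - C (i - + 1)) - (C (i - + 1) - C (i - + 1 - + 1))
    ≡⟨ cong (λ j → (C i - C (i - + 1)) - (C (i - + 1) - C j)) (i-1-1≡i-2 i) ⟩
  (C i - C (i - + 1)) - (C (i - + 1) - C (i - + 2))
    ≡⟨ second-difference (C i) (C (i - + 1)) (C (i - + 2)) ⟩
  (C i - (+ 2) Data.Integer.* C (i - + 1)) + C (i - + 2)
    ∎
  where
  C : ℤ → ℤ
  C j = + choose m j
  i-1-1≡i-2 : ∀ i → i - + 1 - + 1 ≡ i - + 2
  i-1-1≡i-2 = solve-∀
  second-difference : ∀ a b c → (a - b) - (b - c) ≡ (a - (+ 2) Data.Integer.* b) + c
  second-difference = solve-∀

module _ (n : ℕ) where

  Top : Pred Point 0ℓ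
  Top q = g3 q ≡ 2 * n

  BallotFrom : Point → Pred (List Step) 0ℓ
  BallotFrom p w = walk p w ≡ (n , n , n) × All Ordered (pointsFrom p w)

  TopBallotFrom : Point → Pred (List Step) 0ℓ
  TopBallotFrom p w = BallotFrom p w × Any Top (pointsFrom p w)

  ballotFrom? : ∀ p → Decidable (BallotFrom p)
  ballotFrom? p w = (walk p w ≟P (n , n , n)) ×-dec All.all? ordered? (pointsFrom p w)

  topBallotFrom? : ∀ p → Decidable (TopBallotFrom p)
  topBallotFrom? p w = ballotFrom? p w ×-dec Any.any? (λ q → g3 q ℕ.≟ 2 * n) (pointsFrom p w)

  #ballotFrom #topBallotFrom : ℕ → Point → ℕ
  #ballotFrom m p    = count (ballotFrom? p) (words m)
  #topBallotFrom m p = count (topBallotFrom? p) (words m)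

  ballotFrom-ordered : ∀ {p w} → BallotFrom p w → Ordered p
  ballotFrom-ordered {p} {w} (_ , ordered) = All.lookup ordered (start∈pointsFrom p w)

  ballotFrom-x₁≤n : ∀ {p w} → BallotFrom p w → All (λ q → x₁ q ≤ n) (pointsFrom p w)
  ballotFrom-x₁≤n {p} {w} (end , _) =
    All.map (λ (_ , ≤end) → ℕ.≤-trans ≤end (ℕ.≤-reflexive (cong x₁ end)))
            (pointsFrom-between x₁ x₁-move p w)

  ¬top-x₁<n : ∀ {q} → x₁ q < n → ¬ Top q
  ¬top-x₁<n {q} x₁<n top = ℕ.<-irrefl top (ℕ.≤-<-trans (g3≤2x₁ q) (ℕ.*-monoʳ-< 2 x₁<n))

  ¬top-0<x₃ : ∀ {q} → Ordered q → x₁ q ≤ n → 0 < x₃ q → ¬ Top q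
  ¬top-0<x₃ {q} ordered x₁≤n 0<x₃ top =
    ℕ.<-irrefl top (ℕ.<-≤-trans (g3<2x₁ q ordered 0<x₃) (ℕ.*-monoʳ-≤ 2 x₁≤n))

  ballotFrom-∷ : ∀ {p} s → Ordered p → (λ w → BallotFrom p (s ∷ w)) ≐ BallotFrom (move p s)
  ballotFrom-∷ s ordered =
    (λ { (end , _ ∷ os) → end , os }) ,
    (λ (end , os) → end , ordered ∷ os)

  topBallotFrom-∷ : ∀ {p} s → Ordered p → ¬ Top p →
                    (λ w → TopBallotFrom p (s ∷ w)) ≐ TopBallotFrom (move p s)
  topBallotFrom-∷ s ordered ¬top =
    (λ { ((end , _ ∷ os) , hit) → (end , os) , Any.tail ¬top hit }) ,
    (λ ((end , os) , hit) → (end , ordered ∷ os) , there hit)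

  topBallotFrom-top : ∀ {p} → Top p → TopBallotFrom p ≐ BallotFrom p
  topBallotFrom-top {p} top = proj₁ , λ {w} b → b , lose (start∈pointsFrom p w) top

  #ballotFrom-suc : ∀ {p} m → Ordered p →
                    #ballotFrom (suc m) p ≡ Σ-step (λ s → #ballotFrom m (move p s))
  #ballotFrom-suc {p} m ordered =
    trans (count-words-suc (ballotFrom? p) m)
          (Σ-step-cong (λ s → count-cong (λ w → ballotFrom? p (s ∷ w)) (ballotFrom? (move p s))
                                         (ballotFrom-∷ s ordered) (words m)))

  #topBallotFrom-suc : ∀ {p} m → Ordered p → ¬ Top p →
                       #topBallotFrom (suc m) p ≡ Σ-step (λ s → #topBallotFrom m (move p s))
  #topBallotFrom-suc {p} m ordered ¬top =
    trans (count-words-suc (topBallotFrom? p) m)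
          (Σ-step-cong (λ s → count-cong (λ w → topBallotFrom? p (s ∷ w)) (topBallotFrom? (move p s))
                                         (topBallotFrom-∷ s ordered ¬top) (words m)))

  #topBallotFrom-top : ∀ {p} m → Top p → #topBallotFrom m p ≡ #ballotFrom m p
  #topBallotFrom-top {p} m top =
    count-cong (topBallotFrom? p) (ballotFrom? p) (topBallotFrom-top top) (words m)

  #ballotFrom-end : #ballotFrom 0 (n , n , n) ≡ 1
  #ballotFrom-end =
    cong length (filter-accept (ballotFrom? (n , n , n)) {x = []} {xs = []} (refl , (ℕ.≤-refl , ℕ.≤-refl) ∷ []))

  #ballotFrom-unordered : ∀ {p} m → ¬ Ordered p → #ballotFrom m p ≡ 0
  #ballotFrom-unordered {p} m ¬ordered =
    count-empty (ballotFrom? p) (λ _ b → ¬ordered (ballotFrom-ordered b)) (words m)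

  #topBallotFrom-unordered : ∀ {p} m → ¬ Ordered p → #topBallotFrom m p ≡ 0
  #topBallotFrom-unordered {p} m ¬ordered =
    count-empty (topBallotFrom? p) (λ _ (b , _) → ¬ordered (ballotFrom-ordered b)) (words m)

  #ballotFrom-n<x₁ : ∀ {p} m → n < x₁ p → #ballotFrom m p ≡ 0
  #ballotFrom-n<x₁ {p} m n<x₁ =
    count-empty (ballotFrom? p) (λ w b → ℕ.<⇒≱ n<x₁ (All.lookup (ballotFrom-x₁≤n b) (start∈pointsFrom p w)))
                (words m)

  #topBallotFrom-0<x₃ : ∀ {p} m → 0 < x₃ p → #topBallotFrom m p ≡ 0
  #topBallotFrom-0<x₃ {p} m 0<x₃ = count-empty (topBallotFrom? p) never (words m)
    where
    never : Empty (TopBallotFrom p)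
    never w (b@(_ , ordered) , hit) =
      let q , q∈ , top    = find hit
          x₃p≤x₃q , _     = All.lookup (pointsFrom-between x₃ x₃-move p w) q∈
      in ¬top-0<x₃ (All.lookup ordered q∈) (All.lookup (ballotFrom-x₁≤n b) q∈) (ℕ.<-≤-trans 0<x₃ x₃p≤x₃q) top

  height≡2n⇒top : ∀ w → height w ≡ 2 * n → Any Top (points w)
  height≡2n⇒top w height≡ =
    Any.map sym (Any.map⁻ (subst (_∈ map g3 (points w)) height≡
                                 (maximum-∈ (∈-map⁺ g3 (start∈pointsFrom origin w)))))

  top⇒height≡2n : ∀ {w} → BallotFrom origin w → Any Top (points w) → height w ≡ 2 * n
  top⇒height≡2n b hit = ℕ.≤-antisym
    (maximum-≤ (All.map⁺ (All.map (λ {q} x₁≤n → ℕ.≤-trans (g3≤2x₁ q) (ℕ.*-monoʳ-≤ 2 x₁≤n))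
                                  (ballotFrom-x₁≤n b))))
    (∈⇒≤maximum (Any.map⁺ (Any.map sym hit)))

  hasHeight≐topBallotFrom : HasHeight n (2 * n) ≐ TopBallotFrom origin
  hasHeight≐topBallotFrom =
    (λ {w} ((end , ordered) , height≡) →
       (trans (sym (endpoint≡walk w)) end , ordered) , height≡2n⇒top w height≡) ,
    (λ {w} (b@(end , ordered) , hit) →
       (trans (endpoint≡walk w) end , ordered) , top⇒height≡2n b hit)

  D'≡#topBallotFrom : D' (2 * n) n ≡ #topBallotFrom (3 * n) origin
  D'≡#topBallotFrom =
    count-cong (hasHeight? n (2 * n)) (topBallotFrom? origin) hasHeight≐topBallotFrom (words (3 * n))

  #ballotFrom-x₁≡n : ∀ m b c → b ℕ.+ c ≡ m → b ≤ c → c ≤ n →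
                     + #ballotFrom m (n , n ∸ b , n ∸ c) ≡ ballot m (+ b)
  #ballotFrom-x₁≡n zero    zero    zero    _  _   _   = cong +_ #ballotFrom-end
  #ballotFrom-x₁≡n zero    zero    (suc _) () _   _
  #ballotFrom-x₁≡n zero    (suc _) _       () _   _
  #ballotFrom-x₁≡n (suc m) b       c       eq b≤c c≤n = begin
      + #ballotFrom (suc m) (n , n ∸ b , n ∸ c)
    ≡⟨ cong +_ (#ballotFrom-suc m ordered) ⟩
      + Σ-step (λ s → #ballotFrom m (move (n , n ∸ b , n ∸ c) s))
    ≡⟨ +-Σ-step (λ s → #ballotFrom m (move (n , n ∸ b , n ∸ c) s)) ⟩
      + #ballotFrom m (suc n , n ∸ b , n ∸ c) + + #ballotFrom m (n , suc (n ∸ b) , n ∸ c)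
        + + #ballotFrom m (n , n ∸ b , suc (n ∸ c))
    ≡⟨ cong₂ _+_ (cong₂ _+_ (cong +_ (#ballotFrom-n<x₁ m ℕ.≤-refl)) (e₂-step b eq b≤c))
                 (e₃-step b c eq b≤c c≤n) ⟩
      + 0 + ballot m (+ b - + 1) + ballot m (+ b)
    ≡⟨ regroup (ballot m (+ b - + 1)) (ballot m (+ b)) ⟩
      ballot m (+ b) + ballot m (+ b - + 1)
    ≡⟨ ballot-pascal m (+ b) ⟨
      ballot (suc m) (+ b)
    ∎
    where
    ordered : Ordered (n , n ∸ b , n ∸ c)
    ordered = ℕ.m∸n≤m n b , ℕ.∸-monoʳ-≤ n b≤c

    regroup : ∀ x y → + 0 + x + y ≡ y + x
    regroup = solve-∀

    e₂-step : ∀ b → b ℕ.+ c ≡ suc m → b ≤ c →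
              + #ballotFrom m (n , suc (n ∸ b) , n ∸ c) ≡ ballot m (+ b - + 1)
    e₂-step zero    _  _   = cong +_ (#ballotFrom-unordered m (λ (x₂≤x₁ , _) → ℕ.1+n≰n x₂≤x₁))
    e₂-step (suc b) eq b<c = begin
      + #ballotFrom m (n , suc (n ∸ suc b) , n ∸ c)
        ≡⟨ cong (λ y → + #ballotFrom m (n , y , n ∸ c)) (suc[n∸suc[k]]≡n∸k (ℕ.≤-trans b<c c≤n)) ⟩
      + #ballotFrom m (n , n ∸ b , n ∸ c)
        ≡⟨ #ballotFrom-x₁≡n m b c (ℕ.suc-injective eq) (ℕ.<⇒≤ b<c) c≤n ⟩
      ballot m (+ b)
        ∎

    e₃-step : ∀ b c → b ℕ.+ c ≡ suc m → b ≤ c → c ≤ n →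
              + #ballotFrom m (n , n ∸ b , suc (n ∸ c)) ≡ ballot m (+ b)
    e₃-step zero    zero    () _   _
    e₃-step (suc _) zero    _  ()  _
    e₃-step b       (suc c) eq b≤c c<n with b ℕ.≟ suc c
    ... | yes refl = begin
      + #ballotFrom m (n , n ∸ suc c , suc (n ∸ suc c))
        ≡⟨ cong +_ (#ballotFrom-unordered m (λ (_ , x₃≤x₂) → ℕ.1+n≰n x₃≤x₂)) ⟩
      + 0
        ≡⟨ ballot-central c ⟨
      ballot (suc c ℕ.+ c) (+ suc c)
        ≡⟨ cong (λ k → ballot k (+ suc c)) (trans (sym (ℕ.+-suc c c)) (ℕ.suc-injective eq)) ⟩
      ballot m (+ suc c)
        ∎
    ... | no b≢1+c = begin
      + #ballotFrom m (n , n ∸ b , suc (n ∸ suc c))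
        ≡⟨ cong (λ z → + #ballotFrom m (n , n ∸ b , z)) (suc[n∸suc[k]]≡n∸k c<n) ⟩
      + #ballotFrom m (n , n ∸ b , n ∸ c)
        ≡⟨ #ballotFrom-x₁≡n m b c b+c≡m (ℕ.≤-pred (ℕ.≤∧≢⇒< b≤c b≢1+c)) (ℕ.<⇒≤ c<n) ⟩
      ballot m (+ b)
        ∎
      where
      b+c≡m : b ℕ.+ c ≡ m
      b+c≡m = ℕ.suc-injective (trans (sym (ℕ.+-suc b c)) eq)

  #topBallotFrom-corner : ∀ m b → b ℕ.+ n ≡ m → b ≤ n →
                          + #topBallotFrom m (n , n ∸ b , 0) ≡ ballot m (+ b)
  #topBallotFrom-corner m b b+n≡m b≤n = begin
    + #topBallotFrom m (n , n ∸ b , 0)   ≡⟨ cong +_ (#topBallotFrom-top m refl) ⟩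
    + #ballotFrom m (n , n ∸ b , 0)      ≡⟨ cong (λ z → + #ballotFrom m (n , n ∸ b , z)) (ℕ.n∸n≡0 n) ⟨
    + #ballotFrom m (n , n ∸ b , n ∸ n)  ≡⟨ #ballotFrom-x₁≡n m b n b+n≡m b≤n ℕ.≤-refl ⟩
    ballot m (+ b)                       ∎

  #topBallotFrom-x₃≡0 : ∀ m r b → suc r ℕ.+ b ℕ.+ n ≡ m → suc r ≤ b → b ≤ n →
                        + #topBallotFrom m (n ∸ suc r , n ∸ b , 0) ≡ ballot m (+ b) - ballot m (+ r)
  #topBallotFrom-x₃≡0 zero    r b () _   _
  #topBallotFrom-x₃≡0 (suc m) r b eq r<b b≤n = begin
      + #topBallotFrom (suc m) (n ∸ suc r , n ∸ b , 0)
    ≡⟨ cong +_ (#topBallotFrom-suc m ordered ¬top) ⟩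
      + Σ-step (λ s → #topBallotFrom m (move (n ∸ suc r , n ∸ b , 0) s))
    ≡⟨ +-Σ-step (λ s → #topBallotFrom m (move (n ∸ suc r , n ∸ b , 0) s)) ⟩
      + #topBallotFrom m (suc (n ∸ suc r) , n ∸ b , 0) + + #topBallotFrom m (n ∸ suc r , suc (n ∸ b) , 0)
        + + #topBallotFrom m (n ∸ suc r , n ∸ b , 1)
    ≡⟨ cong₂ _+_ (cong₂ _+_ (e₁-step r eq r<b) (e₂-step b eq r<b b≤n)) (cong +_ (#topBallotFrom-0<x₃ m z<s)) ⟩
      (ballot m (+ b) - ballot m (+ r - + 1)) + (ballot m (+ b - + 1) - ballot m (+ r)) + + 0
    ≡⟨ regroup (ballot m (+ b)) (ballot m (+ r - + 1)) (ballot m (+ b - + 1)) (ballot m (+ r)) ⟩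
      (ballot m (+ b) + ballot m (+ b - + 1)) - (ballot m (+ r) + ballot m (+ r - + 1))
    ≡⟨ cong₂ _-_ (ballot-pascal m (+ b)) (ballot-pascal m (+ r)) ⟨
      ballot (suc m) (+ b) - ballot (suc m) (+ r)
    ∎
    where
    r<n : suc r ≤ n
    r<n = ℕ.≤-trans r<b b≤n

    ordered : Ordered (n ∸ suc r , n ∸ b , 0)
    ordered = ℕ.∸-monoʳ-≤ n r<b , z≤n

    ¬top : ¬ Top (n ∸ suc r , n ∸ b , 0)
    ¬top = ¬top-x₁<n {n ∸ suc r , n ∸ b , 0} (ℕ.∸-monoʳ-< z<s r<n)

    regroup : ∀ a a′ c c′ → (a - a′) + (c - c′) + + 0 ≡ (a + c) - (c′ + a′)
    regroup = solve-∀

    e₁-step : ∀ r → suc r ℕ.+ b ℕ.+ n ≡ suc m → suc r ≤ b →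
              + #topBallotFrom m (suc (n ∸ suc r) , n ∸ b , 0) ≡ ballot m (+ b) - ballot m (+ r - + 1)
    e₁-step zero    eq 0<b = begin
      + #topBallotFrom m (suc (n ∸ 1) , n ∸ b , 0)
        ≡⟨ cong (λ x → + #topBallotFrom m (x , n ∸ b , 0)) (suc[n∸suc[k]]≡n∸k (ℕ.≤-trans 0<b b≤n)) ⟩
      + #topBallotFrom m (n , n ∸ b , 0)
        ≡⟨ #topBallotFrom-corner m b (ℕ.suc-injective eq) b≤n ⟩
      ballot m (+ b)
        ≡⟨ ℤ.+-identityʳ (ballot m (+ b)) ⟨
      ballot m (+ b) - ballot m (+ 0 - + 1)
        ∎
    e₁-step (suc r) eq r<b = begin
      + #topBallotFrom m (suc (n ∸ suc (suc r)) , n ∸ b , 0)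
        ≡⟨ cong (λ x → + #topBallotFrom m (x , n ∸ b , 0)) (suc[n∸suc[k]]≡n∸k (ℕ.≤-trans r<b b≤n)) ⟩
      + #topBallotFrom m (n ∸ suc r , n ∸ b , 0)
        ≡⟨ #topBallotFrom-x₃≡0 m r b (ℕ.suc-injective eq) (ℕ.<⇒≤ r<b) b≤n ⟩
      ballot m (+ b) - ballot m (+ r)
        ∎

    e₂-step : ∀ b → suc r ℕ.+ b ℕ.+ n ≡ suc m → suc r ≤ b → b ≤ n →
              + #topBallotFrom m (n ∸ suc r , suc (n ∸ b) , 0) ≡ ballot m (+ b - + 1) - ballot m (+ r)
    e₂-step (suc b) eq r<b b<n with r ℕ.≟ b
    ... | yes refl = begin
      + #topBallotFrom m (n ∸ suc r , suc (n ∸ suc r) , 0)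
        ≡⟨ cong +_ (#topBallotFrom-unordered m (λ (x₂≤x₁ , _) → ℕ.1+n≰n x₂≤x₁)) ⟩
      + 0
        ≡⟨ ℤ.+-inverseʳ (ballot m (+ r)) ⟨
      ballot m (+ r) - ballot m (+ r)
        ∎
    ... | no r≢b = begin
      + #topBallotFrom m (n ∸ suc r , suc (n ∸ suc b) , 0)
        ≡⟨ cong (λ y → + #topBallotFrom m (n ∸ suc r , y , 0)) (suc[n∸suc[k]]≡n∸k b<n) ⟩
      + #topBallotFrom m (n ∸ suc r , n ∸ b , 0)
        ≡⟨ #topBallotFrom-x₃≡0 m r b r+b+n≡m (ℕ.≤∧≢⇒< (ℕ.≤-pred r<b) r≢b) (ℕ.<⇒≤ b<n) ⟩
      ballot m (+ b) - ballot m (+ r)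
        ∎
      where
      r+b+n≡m : suc r ℕ.+ b ℕ.+ n ≡ m
      r+b+n≡m = trans (cong (ℕ._+ n) (sym (ℕ.+-suc r b))) (ℕ.suc-injective eq)

proposition5p6 : (n : ℕ) → 1 ≤ n →
    + D' (2 * n) n ≡ (+ choose (3 * n) (+ n) - (+ 2) Data.Integer.* (+ choose (3 * n) (+ n - + 1))) + + choose (3 * n) (+ n - + 2)
proposition5p6 zero      ()
proposition5p6 n@(suc k) _ = begin
    + D' (2 * n) n
  ≡⟨ cong +_ (D'≡#topBallotFrom n) ⟩
    + #topBallotFrom n (3 * n) origin
  ≡⟨ cong (λ x → + #topBallotFrom n (3 * n) (x , x , 0)) (ℕ.n∸n≡0 n) ⟨
    + #topBallotFrom n (3 * n) (n ∸ n , n ∸ n , 0)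
  ≡⟨ #topBallotFrom-x₃≡0 n (3 * n) k n (n+n+n≡3n n) ℕ.≤-refl ℕ.≤-refl ⟩
    ballot (3 * n) (+ n) - ballot (3 * n) (+ n - + 1)
  ≡⟨ ballot-difference (3 * n) (+ n) ⟩
    (+ choose (3 * n) (+ n) - (+ 2) Data.Integer.* (+ choose (3 * n) (+ n - + 1))) + + choose (3 * n) (+ n - + 2)
  ∎
  where
  n+n+n≡3n : ∀ n → n ℕ.+ n ℕ.+ n ≡ 3 * n
  n+n+n≡3n = ℕ.solve-∀
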